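{- Let $G_1$ and $G_2$ be two vertex-disjoint 2-edge-colored simple graphs with Hamiltonian alternating cycles $C_1=x_0x_1\cdots x_{2n-1}x_0$ and $C_2=y_0y_1\cdots y_{2m-1}y_0$, respectively, and let $G\in G_1\oplus G_2$. If there is no good pair in $G$ (between $C_1$ and $C_2$), and for each $i\in\{1,2\}$ the cycle $C_i$ contains a vertex which is non-singular with respect to $C_{3-i}$, then $G$ is vertex alternating-pancyclic.
   Context: All graphs are simple and 2-edge-colored with colors red and blue. An alternating path/cycle is one in which any two consecutive edges have different colors; a Hamiltonian alternating cycle is an alternating cycle through all vertices of the graph. For vertex-disjoint 2-edge-colored graphs $G_1,G_2$, the colored generalized sum $G_1\oplus G_2$ is the set of 2-edge-colored graphs $G$ with $V(G)=V(G_1)\cup V(G_2)$, $G\langle V(G_i)\rangle$ equal to $G_i$ with its coloring for $i=1,2$, and exactly one edge (of arbitrary fixed color) between every $u\in V(G_1)$ and $w\in V(G_2)$; these latter edges are called exterior. For a vertex $v$ of an alternating cycle $C$, $v^r$ (resp. $v^b$) denotes the vertex of $C$ such that $vv^r\in E(C)$ is red (resp. $vv^b\in E(C)$ is blue). For vertex-disjoint alternating cycles $C_1,C_2$ and an edge $vw$ with $v\in V(C_1)$, $w\in V(C_2)$: if $vw$ is red, the pair $vw, v^rw^r$ is a good pair if $v^rw^r$ is an edge and is red; if $vw$ is blue, the pair $vw,v^bw^b$ is a good pair if $v^bw^b$ is an edge and is blue (here $v^r,v^b$ are taken in $C_1$ and $w^r,w^b$ in $C_2$). A vertex $v\in V(C_i)$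 is red-singular (resp. blue-singular) with respect to $C_{3-i}$ if all edges $vu$ with $u\in V(C_{3-i})$ are red (resp. blue); singular means red- or blue-singular, and non-singular means not singular. A 2-edge-colored graph $G$ of order $2N$ is vertex alternating-pancyclic if for every $v\in V(G)$ and every $\ell\in\{2,\ldots,N\}$ there is an alternating cycle of length $2\ell$ in $G$ through $v$. -}

module Defs where

open import Data.Nat using (ℕ; zero; suc; _*_; _≤_)
open import Data.Fin using (Fin; toℕ)
open import Data.Maybe using (Maybe; just; nothing)
open import Data.Sum using (_⊎_; inj₁; inj₂)
open import Data.Product using (Σ; ∃; ∃-syntax; _×_; _,_)
open import Relation.Nullary using (¬_)
open import Relation.Binary.PropositionalEquality using (_≡_; _≢_)
open import Function.Definitions using (Injective)

data Color : Set where
  red blue : Color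

record CGraph (V : Set) : Set where
  field
    E     : V → V → Maybe Color
    sym   : ∀ u v → E u v ≡ E v u
    irrefl : ∀ v → E v v ≡ nothing
open CGraph public

Next : (L : ℕ) → Fin L → Fin L → Set
Next L i j = (suc (toℕ i) ≡ toℕ j) ⊎ (suc (toℕ i) ≡ L × toℕ j ≡ 0)

record AltCycle {V : Set} (E : V → V → Maybe Color) (L : ℕ) : Set where
  field
    vert : Fin L → V
    inj  : Injective _≡_ _≡_ vert
    col  : Fin L → Color
    edge : ∀ i j → Next L i j → E (vert i) (vert j) ≡ just (col i)
    alt  : ∀ i j → Next L i j → col i ≢ col j
open AltCycle public

Hamiltonian : {V : Set} {E : V → V → Maybe Color} {L : ℕ} → AltCycle E L → Set
Hamiltonian {V} C = ∀ (v : V) → ∃[ i ] vert C i ≡ v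

-- Colored generalized sum: a member of G1 ⊕ G2 is determined by the colour
-- X a b of the unique exterior edge between a ∈ V(G1) and b ∈ V(G2).
sumE : {V₁ V₂ : Set} → CGraph V₁ → CGraph V₂ → (V₁ → V₂ → Color) →
       V₁ ⊎ V₂ → V₁ ⊎ V₂ → Maybe Color
sumE G₁ G₂ X (inj₁ a) (inj₁ b) = E G₁ a b
sumE G₁ G₂ X (inj₁ a) (inj₂ b) = just (X a b)
sumE G₁ G₂ X (inj₂ b) (inj₁ a) = just (X a b)
sumE G₁ G₂ X (inj₂ a) (inj₂ b) = E G₂ a b

-- u is the neighbour of v on the cycle C along the edge of C of colour c
-- (i.e. u = v^c).
CycNbr : {V : Set} {E : V → V → Maybe Color} {L : ℕ} →
         AltCycle E L → V → Color → V → Set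
CycNbr {L = L} C v c u =
  ∃[ i ] ∃[ j ] (vert C i ≡ v × vert C j ≡ u ×
     ((Next L i j × col C i ≡ c) ⊎ (Next L j i × col C j ≡ c)))

GoodPair : {V₁ V₂ : Set} (G₁ : CGraph V₁) (G₂ : CGraph V₂) (X : V₁ → V₂ → Color)
           {L₁ L₂ : ℕ} → AltCycle (E G₁) L₁ → AltCycle (E G₂) L₂ → Set
GoodPair G₁ G₂ X C₁ C₂ =
  ∃[ v ] ∃[ w ] ∃[ c ] ∃[ v' ] ∃[ w' ]
    (sumE G₁ G₂ X (inj₁ v) (inj₂ w) ≡ just c ×
     CycNbr C₁ v c v' × CycNbr C₂ w c w' ×
     sumE G₁ G₂ X (inj₁ v') (inj₂ w') ≡ just c)

SingularL : {V₁ V₂ : Set} (G₁ : CGraph V₁) (G₂ : CGraph V₂) (X : V₁ → V₂ → Color)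
            {L₂ : ℕ} → AltCycle (E G₂) L₂ → Color → V₁ → Set
SingularL G₁ G₂ X C₂ c v = ∀ j → sumE G₁ G₂ X (inj₁ v) (inj₂ (vert C₂ j)) ≡ just c

SingularR : {V₁ V₂ : Set} (G₁ : CGraph V₁) (G₂ : CGraph V₂) (X : V₁ → V₂ → Color)
            {L₁ : ℕ} → AltCycle (E G₁) L₁ → Color → V₂ → Set
SingularR G₁ G₂ X C₁ c w = ∀ i → sumE G₁ G₂ X (inj₂ w) (inj₁ (vert C₁ i)) ≡ just c

-- Vertex alternating-pancyclic, for a graph of order 2N with edge function E.
VertexAltPancyclic : {V : Set} → (E : V → V → Maybe Color) → (N : ℕ) → Set
VertexAltPancyclic {V} E N =
  ∀ (v : V) (ℓ : ℕ) → 2 ≤ ℓ → ℓ ≤ N →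
    Σ (AltCycle E (2 * ℓ)) λ C → ∃[ i ] vert C i ≡ v

module Submission where

-- Unroll C₁ and C₂ into periodic sequences: vertices P₁ k, P₂ l and colours t₁ k, t₂ l of the
-- edges leaving them.  An exterior edge P₁ k P₂ l is an exit if its colour is t₁ k ≠ t₂ l and an
-- entry if it is t₂ l ≠ t₁ k.  Without good pairs an exit at (k, l + 1) forces one at (k + 1, l),
-- so being an exit depends only on the diagonal k + l, periodically modulo 2n and 2m, hence
-- modulo T = 2 gcd(n, m).  Given one exit and one entry there is a diagonal on which exits stop
-- after a step of 2, and one on which they start; following an arc of C₁, an exit, an arc of C₂
-- and an entry back (or two such rounds for the Hamiltonian length), with arc lengths chosen
-- modulo T, gives alternating cycles of every even length through every vertex.  The rows and
-- columns of the two non-singular vertices supply an exit and an entry, either for C₂ or for C₂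
-- traversed backwards.

open import Defs hiding (sym)
open import Data.Nat using (ℕ; zero; suc; pred; _+_; _*_; _∸_; _≤_; _<_; z≤n; s≤s; s≤s⁻¹; NonZero; _≟_; _≤?_; _<?_)
open import Data.Nat.Properties
open import Data.Nat.DivMod
open import Data.Nat.Divisibility using (_∣_; ∣⇒≤)
open import Data.Nat.GCD using (gcd; gcd-GCD; gcd[m,n]∣m; gcd[m,n]∣n; gcd[m,n]≢0; c*gcd[m,n]≡gcd[cm,cn]; module Bézout)
open import Data.Nat.Tactic.RingSolver using (solve-∀)
open import Data.Fin using (Fin; toℕ) renaming (zero to fz; suc to fs)
open import Data.Fin.Properties using (toℕ-injective; toℕ-fromℕ<; toℕ<n; ¬∀⟶∃¬)
open import Data.Maybe using (Maybe; just)
open import Data.Maybe.Properties using (just-injective)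
open import Data.Sum using (_⊎_; inj₁; inj₂; swap) renaming (map to map⊎)
open import Data.Sum.Properties using (inj₁-injective; inj₂-injective; swap-involutive)
open import Data.Product using (Σ; ∃-syntax; _×_; _,_; proj₁; proj₂)
open import Data.Unit using (⊤)
open import Data.Empty using (⊥-elim)
open import Data.List using (List; []; _∷_; _++_; length; map; lookup)
open import Data.List.Properties using (length-++; map-++)
open import Data.List.Relation.Unary.All as All using (All; []; _∷_)
open import Data.List.Relation.Unary.AllPairs using ([]; _∷_)
open import Data.List.Relation.Unary.Any using (here; there)
open import Data.List.Relation.Unary.Unique.Propositional using (Unique)
import Data.List.Relation.Unary.Unique.Propositional.Properties as Unique
open import Data.List.Relation.Binary.Disjoint.Propositional using (Disjoint)
open import Data.List.Membership.Propositional using (_∈_)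
open import Data.List.Membership.Propositional.Properties using (∈-lookup; ∈-map⁺; ∈-map⁻; ∈-++⁻)
open import Function using (_∘_)
open import Function.Bundles using (_⇔_; mk⇔; Equivalence)
import Function.Properties.Equivalence as ⇔
open import Function.Definitions using (Injective)
open import Relation.Nullary using (¬_; yes; no; Dec)
open import Relation.Nullary.Decidable using (¬?; decidable-stable)
open import Relation.Unary using (Decidable)
open import Relation.Binary.PropositionalEquality
  using (_≡_; _≢_; refl; sym; trans; cong; cong₂; subst; ≢-sym; module ≡-Reasoning)

open Equivalence using (to; from)

+-suc-* : ∀ s c p → s + suc c * p ≡ s + c * p + p
+-suc-* = solve-∀

periodic-+* : ∀ {A : Set} {p} (f : ℕ → A) → (∀ k → f (k + p) ≡ f k) → ∀ k c → f (k + c * p) ≡ f k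
periodic-+* f f-+p k zero = cong f (+-identityʳ k)
periodic-+* {p = p} f f-+p k (suc c) = trans (cong f (+-suc-* k c p)) (trans (f-+p (k + c * p)) (periodic-+* f f-+p k c))

Periodic : (ℕ → Set) → ℕ → Set
Periodic Z p = ∀ s → Z (s + p) ⇔ Z s

module _ {Z : ℕ → Set} where

  Periodic-* : ∀ {p} → Periodic Z p → ∀ s c → Z (s + c * p) ⇔ Z s
  Periodic-* per s zero = subst (λ x → Z x ⇔ Z s) (sym (+-identityʳ s)) ⇔.refl
  Periodic-* {p} per s (suc c) =
    subst (λ x → Z x ⇔ Z s) (sym (+-suc-* s c p)) (⇔.trans (per (s + c * p)) (Periodic-* per s c))

  private
    Periodic-bézout⁺ : ∀ {d m n} x y → d + y * n ≡ x * m → Periodic Z m → Periodic Z n → Periodic Z d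
    Periodic-bézout⁺ {d} {m} {n} x y eq per-m per-n s =
      ⇔.trans (⇔.sym (Periodic-* per-n (s + d) y))
        (subst (λ z → Z z ⇔ Z s) (sym (trans (+-assoc s d (y * n)) (cong (s +_) eq))) (Periodic-* per-m s x))

  Periodic-bézout : ∀ {d m n} → Bézout.Identity d m n → Periodic Z m → Periodic Z n → Periodic Z d
  Periodic-bézout (Bézout.+- x y eq) per-m per-n = Periodic-bézout⁺ x y eq per-m per-n
  Periodic-bézout (Bézout.-+ x y eq) per-m per-n = Periodic-bézout⁺ y x eq per-n per-m

  Periodic⇒%-cong : ∀ {p} .{{_ : NonZero p}} → Periodic Z p → ∀ {s s'} → s % p ≡ s' % p → Z s ⇔ Z s'
  Periodic⇒%-cong {p} per {s} {s'} eq =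
    ⇔.trans (reduce s) (subst (λ r → Z r ⇔ Z s') (sym eq) (⇔.sym (reduce s')))
    where
    reduce : ∀ s → Z s ⇔ Z (s % p)
    reduce s = subst (λ x → Z x ⇔ Z (s % p)) (sym (m≡m%n+[m/n]*n s p)) (Periodic-* per (s % p) (s / p))

%-cong-+ˡ : ∀ x {q q'} T .{{_ : NonZero T}} → q % T ≡ q' % T → (x + q) % T ≡ (x + q') % T
%-cong-+ˡ x {q} {q'} T eq = trans (%-distribˡ-+ x q T) (trans (cong (λ r → (x % T + r) % T) eq) (sym (%-distribˡ-+ x q' T)))

change-by-2 : ∀ {Z : ℕ → Set} → Decidable Z → ∀ c x → Z x → ¬ Z (x + 2 * c) → ∃[ y ] Z y × ¬ Z (suc (suc y))
change-by-2 {Z} Z? zero x Zx ¬Zx = ⊥-elim (¬Zx (subst Z (sym (+-identityʳ x)) Zx))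
change-by-2 {Z} Z? (suc c) x Zx ¬Zx+2c with Z? (suc (suc x))
... | no ¬Zx+2 = x , Zx , ¬Zx+2
... | yes Zx+2 = change-by-2 Z? c (suc (suc x)) Zx+2 (subst (¬_ ∘ Z) (shift x c) ¬Zx+2c)
  where
  shift : ∀ x c → x + 2 * suc c ≡ suc (suc x) + 2 * c
  shift = solve-∀

long-arc-lengths : ∀ n m L → 0 < n → n < 2 + L → m < 2 + L → 2 + L < n + m →
  ∃[ p ] ∃[ q ] p < 2 * n × q < 2 * m × 2 + (p + q) ≡ 2 * (2 + L) × q + 2 * n ≡ 2 + p + 2 * m
long-arc-lengths n m L 0<n n<ℓ m<ℓ ℓ<n+m = p , q , p<2n , q<2m , length≡ , across
  where
  open ≡-Reasoning
  p = L + n ∸ m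
  q = 2 + L + m ∸ n
  p+m≡ : p + m ≡ L + n
  p+m≡ = m∸n+n≡m (≤-trans (s≤s⁻¹ m<ℓ) (subst (_≤ L + n) (+-comm L 1) (+-monoʳ-≤ L 0<n)))
  q+n≡ : q + n ≡ 2 + L + m
  q+n≡ = m∸n+n≡m (≤-trans (<⇒≤ n<ℓ) (m≤m+n (2 + L) m))
  length≡ : 2 + (p + q) ≡ 2 * (2 + L)
  length≡ = +-cancelʳ-≡ (m + n) (2 + (p + q)) (2 * (2 + L)) (begin
    2 + (p + q) + (m + n)     ≡⟨ regroup p q m n ⟩
    2 + (p + m) + (q + n)     ≡⟨ cong₂ (λ x y → 2 + x + y) p+m≡ q+n≡ ⟩
    2 + (L + n) + (2 + L + m) ≡⟨ regroup′ L m n ⟩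
    2 * (2 + L) + (m + n)     ∎)
    where
    regroup : ∀ p q m n → 2 + (p + q) + (m + n) ≡ 2 + (p + m) + (q + n)
    regroup = solve-∀
    regroup′ : ∀ L m n → 2 + (L + n) + (2 + L + m) ≡ 2 * (2 + L) + (m + n)
    regroup′ = solve-∀
  across : q + 2 * n ≡ 2 + p + 2 * m
  across = begin
    q + 2 * n           ≡⟨ split q n ⟩
    q + n + n           ≡⟨ cong (_+ n) q+n≡ ⟩
    2 + L + m + n       ≡⟨ reorder L m n ⟩
    2 + (L + n) + m     ≡⟨ cong (λ x → 2 + x + m) (sym p+m≡) ⟩
    2 + (p + m) + m     ≡⟨ merge p m ⟩
    2 + p + 2 * m       ∎
    where
    split : ∀ q n → q + 2 * n ≡ q + n + n
    split = solve-∀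
    reorder : ∀ L m n → 2 + L + m + n ≡ 2 + (L + n) + m
    reorder = solve-∀
    merge : ∀ p m → 2 + (p + m) + m ≡ 2 + p + 2 * m
    merge = solve-∀
  p<2n : p < 2 * n
  p<2n = +-cancelʳ-< m p (2 * n) (subst (_< 2 * n + m) (sym p+m≡)
           (subst (L + n <_) (regroup n m) (+-monoˡ-< n (<-trans (m<n+m L (s≤s z≤n)) ℓ<n+m))))
    where regroup : ∀ n m → n + m + n ≡ 2 * n + m
          regroup = solve-∀
  q<2m : q < 2 * m
  q<2m = +-cancelʳ-< n q (2 * m) (subst (_< 2 * m + n) (sym q+n≡)
           (subst (2 + L + m <_) (regroup n m) (+-monoˡ-< m ℓ<n+m)))
    where regroup : ∀ n m → n + m + m ≡ 2 * m + n
          regroup = solve-∀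

both-or-both : ∀ {A B C D : Set} → A ⊎ B → C ⊎ D → C ⊎ B → A ⊎ D → (A × C) ⊎ (B × D)
both-or-both (inj₁ a) (inj₁ c) _ _ = inj₁ (a , c)
both-or-both (inj₂ b) (inj₂ d) _ _ = inj₂ (b , d)
both-or-both (inj₁ a) (inj₂ d) (inj₁ c) _ = inj₁ (a , c)
both-or-both (inj₁ a) (inj₂ d) (inj₂ b) _ = inj₂ (b , d)
both-or-both (inj₂ b) (inj₁ c) _ (inj₁ a) = inj₁ (a , c)
both-or-both (inj₂ b) (inj₁ c) _ (inj₂ d) = inj₂ (b , d)

opp : Color → Color
opp red = blue
opp blue = red

opp-≢ : ∀ c → c ≢ opp c
opp-≢ red ()
opp-≢ blue ()

≢⇒≡opp : ∀ {c d} → c ≢ d → d ≡ opp c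
≢⇒≡opp {red} {red} c≢d = ⊥-elim (c≢d refl)
≢⇒≡opp {red} {blue} _ = refl
≢⇒≡opp {blue} {red} _ = refl
≢⇒≡opp {blue} {blue} c≢d = ⊥-elim (c≢d refl)

opp-involutive : ∀ c → opp (opp c) ≡ c
opp-involutive red = refl
opp-involutive blue = refl

≢opp⇒≡ : ∀ {c d} → c ≢ opp d → d ≡ c
≢opp⇒≡ {red} {red} _ = refl
≢opp⇒≡ {red} {blue} c≢ = ⊥-elim (c≢ refl)
≢opp⇒≡ {blue} {red} c≢ = ⊥-elim (c≢ refl)
≢opp⇒≡ {blue} {blue} _ = refl

_≟ᶜ_ : (c d : Color) → Dec (c ≡ d)
red ≟ᶜ red = yes refl
red ≟ᶜ blue = no λ ()
blue ≟ᶜ red = no λ ()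
blue ≟ᶜ blue = yes refl

module _ (t : ℕ → Color) (t-suc : ∀ k → t (suc k) ≡ opp (t k)) where

  t-parity : ∀ a d → (t (a + d) ≡ t a → ∃[ c ] d ≡ 2 * c) × (t (a + d) ≡ opp (t a) → ∃[ c ] d ≡ suc (2 * c))
  t-parity a zero = (λ _ → 0 , refl) , λ e → ⊥-elim (opp-≢ (t a) (trans (sym (cong t (+-identityʳ a))) e))
  t-parity a (suc d) = even , odd
    where
    t-step : t (a + suc d) ≡ opp (t (a + d))
    t-step = trans (cong t (+-suc a d)) (t-suc (a + d))
    even : t (a + suc d) ≡ t a → ∃[ c ] suc d ≡ 2 * c
    even e with proj₂ (t-parity a d) (trans (sym (opp-involutive _)) (cong opp (trans (sym t-step) e)))
    ... | c , d≡ = suc c , cong suc (trans d≡ (sym (+-suc c (c + 0))))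
    odd : t (a + suc d) ≡ opp (t a) → ∃[ c ] suc d ≡ suc (2 * c)
    odd e with proj₁ (t-parity a d) (trans (sym (opp-involutive _)) (trans (cong opp (trans (sym t-step) e)) (opp-involutive _)))
    ... | c , d≡ = c , cong suc d≡

non-singular⇒all-colours : ∀ {L} (f : Fin L → Color) →
  ¬ ((∀ j → just (f j) ≡ just red) ⊎ (∀ j → just (f j) ≡ just blue)) → ∀ c → ∃[ j ] f j ≡ c
non-singular⇒all-colours {L} f non-singular red with ¬∀⟶∃¬ L _ (λ j → f j ≟ᶜ blue) (λ all-blue → non-singular (inj₂ (λ j → cong just (all-blue j))))
... | j , fj≢blue = j , ≢⇒≡opp (≢-sym fj≢blue)
non-singular⇒all-colours {L} f non-singular blue with ¬∀⟶∃¬ L _ (λ j → f j ≟ᶜ red) (λ all-red → non-singular (inj₁ (λ j → cong just (all-red j))))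
... | j , fj≢red = j , ≢⇒≡opp (≢-sym fj≢red)

Unique-map⇒lookup-injective : ∀ {A B : Set} (f : A → B) (xs : List A) → Unique (map f xs) →
                              ∀ i j → f (lookup xs i) ≡ f (lookup xs j) → i ≡ j
Unique-map⇒lookup-injective f (x ∷ xs) u fz fz _ = refl
Unique-map⇒lookup-injective f (x ∷ xs) (x∉ ∷ _) fz (fs j) e =
  ⊥-elim (All.lookup x∉ (∈-map⁺ f (∈-lookup j)) e)
Unique-map⇒lookup-injective f (x ∷ xs) (x∉ ∷ _) (fs i) fz e =
  ⊥-elim (All.lookup x∉ (∈-map⁺ f (∈-lookup i)) (sym e))
Unique-map⇒lookup-injective f (x ∷ xs) (_ ∷ u) (fs i) (fs j) e =
  cong fs (Unique-map⇒lookup-injective f xs u i j e)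

module _ {A B : Set} where

  Disjoint-inj₁-inj₂ : ∀ (xs : List A) (ys : List B) → Disjoint (map inj₁ xs) (map inj₂ ys)
  Disjoint-inj₁-inj₂ xs ys (x∈ , y∈) with ∈-map⁻ inj₁ x∈ | ∈-map⁻ inj₂ y∈
  ... | _ , _ , refl | _ , _ , ()

  Disjoint-map⁺ : ∀ {f : A → B} {xs ys} → Injective _≡_ _≡_ f → Disjoint xs ys → Disjoint (map f xs) (map f ys)
  Disjoint-map⁺ {f} f-inj xs#ys (x∈ , y∈) with ∈-map⁻ f x∈ | ∈-map⁻ f y∈
  ... | a , a∈ , refl | b , b∈ , fa≡fb = xs#ys (a∈ , subst (_∈ _) (sym (f-inj fa≡fb)) b∈)

Disjoint-++⁺ʳ : ∀ {A : Set} {xs ys zs : List A} → Disjoint xs ys → Disjoint xs zs → Disjoint xs (ys ++ zs)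
Disjoint-++⁺ʳ {ys = ys} xs#ys xs#zs (x∈ , x∈ys++zs) with ∈-++⁻ ys x∈ys++zs
... | inj₁ x∈ys = xs#ys (x∈ , x∈ys)
... | inj₂ x∈zs = xs#zs (x∈ , x∈zs)

Disjoint-sym : ∀ {A : Set} {xs ys : List A} → Disjoint xs ys → Disjoint ys xs
Disjoint-sym xs#ys (y∈ , x∈) = xs#ys (x∈ , y∈)

Unique-interleave : ∀ {A B : Set} {xs ys : List A} {zs ws : List B} →
  Unique xs → Unique ys → Disjoint xs ys → Unique zs → Unique ws → Disjoint zs ws →
  Unique (map inj₁ xs ++ map inj₂ zs ++ map inj₁ ys ++ map inj₂ ws)
Unique-interleave {xs = xs} {ys} {zs} {ws} xs! ys! xs#ys zs! ws! zs#ws =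
  Unique.++⁺ (Unique.map⁺ inj₁-injective xs!)
    (Unique.++⁺ (Unique.map⁺ inj₂-injective zs!)
      (Unique.++⁺ (Unique.map⁺ inj₁-injective ys!) (Unique.map⁺ inj₂-injective ws!) (Disjoint-inj₁-inj₂ ys ws))
      (Disjoint-++⁺ʳ (Disjoint-sym (Disjoint-inj₁-inj₂ ys zs)) (Disjoint-map⁺ inj₂-injective zs#ws)))
    (Disjoint-++⁺ʳ (Disjoint-inj₁-inj₂ xs zs)
      (Disjoint-++⁺ʳ (Disjoint-map⁺ inj₁-injective xs#ys) (Disjoint-inj₁-inj₂ xs ws)))

-- A walk is a list of stops: a vertex together with the colour of the edge leaving it.
module AltWalks {V : Set} (E : V → V → Maybe Color) where

  Stop : Set
  Stop = V × Color

  Step : Stop → Stop → Set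
  Step (v , c) (w , d) = E v w ≡ just c × c ≢ d

  AltWalk : List Stop → Set
  AltWalk [] = ⊤
  AltWalk (_ ∷ []) = ⊤
  AltWalk (x ∷ y ∷ ys) = Step x y × AltWalk (y ∷ ys)

  lastStop : Stop → List Stop → Stop
  lastStop x [] = x
  lastStop _ (y ∷ ys) = lastStop y ys

  lastStop-++ : ∀ x xs y ys → lastStop x (xs ++ y ∷ ys) ≡ lastStop y ys
  lastStop-++ x [] y ys = refl
  lastStop-++ x (x' ∷ xs) y ys = lastStop-++ x' xs y ys

  AltWalk-++ : ∀ x xs y ys → AltWalk (x ∷ xs) → Step (lastStop x xs) y → AltWalk (y ∷ ys) →
               AltWalk (x ∷ xs ++ y ∷ ys)
  AltWalk-++ x [] y ys _ step wy = step , wy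
  AltWalk-++ x (x' ∷ xs) y ys (s , wx) step wy = s , AltWalk-++ x' xs y ys wx step wy

  AltWalk-lookup : ∀ xs → AltWalk xs → (i j : Fin (length xs)) → suc (toℕ i) ≡ toℕ j →
                   Step (lookup xs i) (lookup xs j)
  AltWalk-lookup (x ∷ y ∷ ys) (s , _) fz (fs fz) _ = s
  AltWalk-lookup (x ∷ y ∷ ys) (_ , w) (fs i) (fs j) e = AltWalk-lookup (y ∷ ys) w i j (cong pred e)
  AltWalk-lookup (x ∷ y ∷ ys) _ fz (fs (fs j)) ()

  lookup-last : ∀ x xs (i : Fin (suc (length xs))) → toℕ i ≡ length xs →
                lookup (x ∷ xs) i ≡ lastStop x xs
  lookup-last x [] fz _ = refl
  lookup-last x (y ∷ ys) (fs i) e = lookup-last y ys i (cong pred e)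

  closeWalk : ∀ x xs → AltWalk (x ∷ xs) → Step (lastStop x xs) x → Unique (map proj₁ (x ∷ xs)) →
              AltCycle E (suc (length xs))
  closeWalk x xs walk closing unique = record
    { vert = λ i → proj₁ (lookup (x ∷ xs) i)
    ; inj = λ {i} {j} → Unique-map⇒lookup-injective proj₁ (x ∷ xs) unique i j
    ; col = λ i → proj₂ (lookup (x ∷ xs) i)
    ; edge = λ i j next → proj₁ (stepAt i j next)
    ; alt = λ i j next → proj₂ (stepAt i j next)
    }
    where
    stepAt : ∀ i j → Next (suc (length xs)) i j → Step (lookup (x ∷ xs) i) (lookup (x ∷ xs) j)
    stepAt i j (inj₁ e) = AltWalk-lookup (x ∷ xs) walk i j e
    stepAt i j (inj₂ (i-last , j≡0))
      rewrite lookup-last x xs i (cong pred i-last) | toℕ-injective {j = fz} j≡0 = closing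

-- An alternating Hamiltonian cycle of length N, unrolled along ℕ: P k is its vertex with
-- index k mod N and t k the colour of the edge P k P (k + 1).  Nbr v c u is the relation
-- "u = v^c" in which the cycle is read; it is kept abstract so that reversing the
-- unrolling (below) does not change it.
record PeriodicCycle {V : Set} (E : V → V → Maybe Color) (N : ℕ) (Nbr : V → Color → V → Set) : Set where
  field
    P : ℕ → V
    t : ℕ → Color
    P-edge : ∀ k → E (P k) (P (suc k)) ≡ just (t k)
    t-suc : ∀ k → t (suc k) ≡ opp (t k)
    P-+N : ∀ k → P (k + N) ≡ P k
    t-+N : ∀ k → t (k + N) ≡ t k
    P-injective : ∀ a d → 0 < d → d < N → P a ≢ P (a + d)
    P-surjective : ∀ v → ∃[ k ] P k ≡ v
    Nbr-suc : ∀ k → Nbr (P k) (t k) (P (suc k))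
    Nbr-pred : ∀ k → Nbr (P (suc k)) (t k) (P k)

module _ {V : Set} {E : V → V → Maybe Color} {N : ℕ} {Nbr : V → Color → V → Set}
         (C : PeriodicCycle E N Nbr) where
  open PeriodicCycle C

  P-+*N : ∀ k c → P (k + c * N) ≡ P k
  P-+*N = periodic-+* P P-+N

  t-+*N : ∀ k c → t (k + c * N) ≡ t k
  t-+*N = periodic-+* t t-+N

  t-≢-suc : ∀ k → t k ≢ t (suc k)
  t-≢-suc k e = opp-≢ (t k) (trans e (t-suc k))

module Mod (N' : ℕ) where
  N : ℕ
  N = suc (suc N')

  toℕ-mod : ∀ k → toℕ (k mod N) ≡ k % N
  toℕ-mod k = toℕ-fromℕ< (m%n<n k N)

  %-injective : ∀ {a b} → a % N ≡ b % N → a mod N ≡ b mod N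
  %-injective {a} {b} e = toℕ-injective (trans (toℕ-mod a) (trans e (sym (toℕ-mod b))))

  mod-toℕ : ∀ (i : Fin N) → toℕ i mod N ≡ i
  mod-toℕ i = toℕ-injective (trans (toℕ-mod (toℕ i)) (m<n⇒m%n≡m (toℕ<n i)))

  1<N : 1 < N
  1<N = s≤s (s≤s z≤n)

  suc-% : ∀ k → suc k % N ≡ suc (k % N) % N
  suc-% k = trans (%-distribˡ-+ 1 k N) (cong (λ z → (z + k % N) % N) (m<n⇒m%n≡m 1<N))

  Next-mod : ∀ k → Next N (k mod N) (suc k mod N)
  Next-mod k with suc (k % N) <? N
  ... | yes lt = inj₁ (trans (cong suc (toℕ-mod k))
                   (sym (trans (toℕ-mod (suc k)) (trans (suc-% k) (m<n⇒m%n≡m lt)))))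
  ... | no nlt = inj₂ (trans (cong suc (toℕ-mod k)) wraps ,
                       trans (toℕ-mod (suc k)) (trans (suc-% k) (trans (cong (_% N) wraps) (n%n≡0 N))))
    where
    wraps : suc (k % N) ≡ N
    wraps = ≤-antisym (m%n<n k N) (≮⇒≥ nlt)

  %-+-≢ : ∀ a d → 0 < d → d < N → a % N ≢ (a + d) % N
  %-+-≢ a d 0<d d<N e with a % N + d <? N
  ... | yes lt = <⇒≢ (m<m+n (a % N) 0<d) (trans e (trans shift (m<n⇒m%n≡m lt)))
    where
    shift : (a + d) % N ≡ (a % N + d) % N
    shift = trans (%-distribˡ-+ a d N) (cong (λ z → (a % N + z) % N) (m<n⇒m%n≡m d<N))
  ... | no nlt = <⇒≢ d<N (+-cancelˡ-≡ r d N (sym (trans (cong (_+ N) (trans e wrapped)) (m∸n+n≡m N≤r+d))))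
    where
    r = a % N
    N≤r+d : N ≤ r + d
    N≤r+d = ≮⇒≥ nlt
    r+d∸N<N : r + d ∸ N < N
    r+d∸N<N = +-cancelʳ-< N (r + d ∸ N) N
      (subst (_< N + N) (sym (m∸n+n≡m N≤r+d)) (+-mono-< (m%n<n a N) d<N))
    wrapped : (a + d) % N ≡ r + d ∸ N
    wrapped = trans (%-distribˡ-+ a d N) (trans (cong (λ z → (r + z) % N) (m<n⇒m%n≡m d<N))
                (trans (sym (m≤n⇒[n∸m]%m≡n%m N≤r+d)) (m<n⇒m%n≡m r+d∸N<N)))

unroll : ∀ N' {V : Set} {E : V → V → Maybe Color} (C : AltCycle E (suc (suc N'))) → Hamiltonian C →
         PeriodicCycle E (suc (suc N')) (CycNbr C)
unroll N' {V} C ham = record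
  { P = P
  ; t = t
  ; P-edge = λ k → edge C _ _ (Next-mod k)
  ; t-suc = λ k → ≢⇒≡opp (alt C _ _ (Next-mod k))
  ; P-+N = λ k → cong (vert C) (%-injective {k + N} {k} ([m+n]%n≡m%n k N))
  ; t-+N = λ k → cong (col C) (%-injective {k + N} {k} ([m+n]%n≡m%n k N))
  ; P-injective = λ a d 0<d d<N e → %-+-≢ a d 0<d d<N
      (trans (sym (toℕ-mod a)) (trans (cong toℕ (inj C e)) (toℕ-mod (a + d))))
  ; P-surjective = λ v → toℕ (proj₁ (ham v)) , trans (cong (vert C) (mod-toℕ (proj₁ (ham v)))) (proj₂ (ham v))
  ; Nbr-suc = λ k → k mod N , suc k mod N , refl , refl , inj₁ (Next-mod k , refl)
  ; Nbr-pred = λ k → suc k mod N , k mod N , refl , refl , inj₂ (Next-mod k , refl)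
  }
  where
  open Mod N'
  P : ℕ → V
  P k = vert C (k mod N)
  t : ℕ → Color
  t k = col C (k mod N)

-- Reading the cycle backwards: index k of the reversed cycle is k (N - 1) ≡ - k (mod N).
module Reverse (N' : ℕ) {V : Set} {E : V → V → Maybe Color} {Nbr : V → Color → V → Set}
               (E-sym : ∀ u v → E u v ≡ E v u) (C : PeriodicCycle E (suc (suc N')) Nbr) where
  open PeriodicCycle C

  N∸1 : ℕ
  N∸1 = suc N'

  private
    N : ℕ
    N = suc (suc N')

    P-suc-pred : ∀ k → P (suc (suc k * N∸1)) ≡ P (k * N∸1)
    P-suc-pred k = trans (cong P (+-comm N (k * N∸1))) (P-+N (k * N∸1))

    t-pred : ∀ y → t (N∸1 + y) ≡ opp (t y)
    t-pred y = trans (sym (opp-involutive _))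
                 (cong opp (trans (sym (t-suc (N∸1 + y))) (trans (cong t (+-comm N y)) (t-+N y))))

    square : ∀ k → k * N∸1 * N∸1 ≡ k + k * N' * N
    square k = lemma k N'
      where lemma : ∀ k n → k * suc n * suc n ≡ k + k * n * suc (suc n)
            lemma = solve-∀

    P-square : ∀ k → P (k * N∸1 * N∸1) ≡ P k
    P-square k = trans (cong P (square k)) (P-+*N C k (k * N'))

  reversed : PeriodicCycle E N Nbr
  reversed = record
    { P = λ k → P (k * N∸1)
    ; t = λ k → t (suc k * N∸1)
    ; P-edge = λ k → trans (E-sym _ _)
        (subst (λ z → E (P (suc k * N∸1)) z ≡ just (t (suc k * N∸1))) (P-suc-pred k) (P-edge (suc k * N∸1)))
    ; t-suc = λ k → t-pred (suc k * N∸1)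
    ; P-+N = λ k → trans (cong P (+N-* k N')) (P-+*N C (k * N∸1) N∸1)
    ; t-+N = λ k → trans (cong t (+N-* (suc k) N')) (t-+*N C (suc k * N∸1) N∸1)
    ; P-injective = λ a d 0<d d<N e → P-injective ((a + d) * N∸1) d 0<d d<N
        (trans (sym e) (sym (trans (cong P (shift a d N')) (P-+*N C (a * N∸1) d))))
    ; P-surjective = λ v → let (k , Pk≡v) = P-surjective v in k * N∸1 , trans (P-square k) Pk≡v
    ; Nbr-suc = λ k → subst (λ z → Nbr z (t (suc k * N∸1)) (P (suc k * N∸1))) (P-suc-pred k) (Nbr-pred (suc k * N∸1))
    ; Nbr-pred = λ k → subst (Nbr (P (suc k * N∸1)) (t (suc k * N∸1))) (P-suc-pred k) (Nbr-suc (suc k * N∸1))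
    }
    where
    +N-* : ∀ k n → (k + suc (suc n)) * suc n ≡ k * suc n + suc n * suc (suc n)
    +N-* = solve-∀
    shift : ∀ a d n → (a + d) * suc n + d ≡ a * suc n + d * suc (suc n)
    shift = solve-∀

  reversed-P : ∀ k → PeriodicCycle.P reversed (k * N∸1) ≡ P k
  reversed-P = P-square

  reversed-t : ∀ k → PeriodicCycle.t reversed (k * N∸1) ≡ opp (t k)
  reversed-t k = trans (t-pred (k * N∸1 * N∸1)) (cong opp (trans (cong t (square k)) (t-+*N C k (k * N'))))

module Arcs {V W : Set} {E : V → V → Maybe Color} {N : ℕ} {Nbr : V → Color → V → Set}
            (C : PeriodicCycle E N Nbr) {E' : W → W → Maybe Color} (ι : V → W)
            (ι-edge : ∀ u v → E' (ι u) (ι v) ≡ E u v) where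
  open PeriodicCycle C
  open AltWalks E'

  stop : ℕ → Stop
  stop k = ι (P k) , t k

  arc : ℕ → ℕ → List Stop
  arc a zero = []
  arc a (suc len) = stop a ∷ arc (suc a) len

  arcVertices : ℕ → ℕ → List V
  arcVertices a zero = []
  arcVertices a (suc len) = P a ∷ arcVertices (suc a) len

  length-arc : ∀ a len → length (arc a len) ≡ len
  length-arc a zero = refl
  length-arc a (suc len) = cong suc (length-arc (suc a) len)

  map-proj₁-arc : ∀ a len → map proj₁ (arc a len) ≡ map ι (arcVertices a len)
  map-proj₁-arc a zero = refl
  map-proj₁-arc a (suc len) = cong (ι (P a) ∷_) (map-proj₁-arc (suc a) len)

  AltWalk-arc : ∀ a len → AltWalk (stop a ∷ arc (suc a) len)
  AltWalk-arc a zero = _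
  AltWalk-arc a (suc len) = (trans (ι-edge _ _) (P-edge a) , t-≢-suc C a) , AltWalk-arc (suc a) len

  lastStop-arc : ∀ a len → lastStop (stop a) (arc (suc a) len) ≡ stop (a + len)
  lastStop-arc a zero rewrite +-identityʳ a = refl
  lastStop-arc a (suc len) rewrite +-suc a len = lastStop-arc (suc a) len

  ∈-arcVertices : ∀ {v} a len → v ∈ arcVertices a len → ∃[ i ] i < len × v ≡ P (a + i)
  ∈-arcVertices a (suc len) (here refl) = 0 , s≤s z≤n , cong P (sym (+-identityʳ a))
  ∈-arcVertices a (suc len) (there v∈) with ∈-arcVertices (suc a) len v∈
  ... | i , i<len , refl = suc i , s≤s i<len , cong P (sym (+-suc a i))

  Unique-arcVertices : ∀ a len → len ≤ N → Unique (arcVertices a len)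
  Unique-arcVertices a zero _ = []
  Unique-arcVertices a (suc len) len<N =
    All.tabulate P-a∉ ∷ Unique-arcVertices (suc a) len (≤-trans (n≤1+n len) len<N)
    where
    P-a∉ : ∀ {v} → v ∈ arcVertices (suc a) len → P a ≢ v
    P-a∉ v∈ with ∈-arcVertices (suc a) len v∈
    ... | i , i<len , refl = λ e → P-injective a (suc i) (s≤s z≤n) (<-≤-trans (s≤s i<len) len<N)
                                      (trans e (cong P (sym (+-suc a i))))

  Disjoint-arcVertices : ∀ a x y → x + y ≤ N → Disjoint (arcVertices a x) (arcVertices (a + x) y)
  Disjoint-arcVertices a x y x+y≤N (v∈ , w∈) with ∈-arcVertices a x v∈ | ∈-arcVertices (a + x) y w∈
  ... | i , i<x , refl | j , j<y , e =
    P-injective (a + i) (x ∸ i + j) (<-≤-trans (m<n⇒0<n∸m i<x) (m≤m+n (x ∸ i) j))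
      (≤-<-trans (+-monoˡ-≤ j (m∸n≤m x i)) (<-≤-trans (+-monoʳ-< x j<y) x+y≤N))
      (trans e (cong P (sym index≡)))
    where
    index≡ : a + i + (x ∸ i + j) ≡ a + x + j
    index≡ = begin
      a + i + (x ∸ i + j)   ≡⟨ +-assoc a i (x ∸ i + j) ⟩
      a + (i + (x ∸ i + j)) ≡⟨ cong (a +_) (sym (+-assoc i (x ∸ i) j)) ⟩
      a + (i + (x ∸ i) + j) ≡⟨ cong (λ z → a + (z + j)) (m+[n∸m]≡n (<⇒≤ i<x)) ⟩
      a + (x + j)           ≡⟨ sym (+-assoc a x j) ⟩
      a + x + j             ∎
      where open ≡-Reasoning

  map-proj₁-arc-++ : ∀ a len zs → map proj₁ (arc a len ++ zs) ≡ map ι (arcVertices a len) ++ map proj₁ zs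
  map-proj₁-arc-++ a len zs = trans (map-++ proj₁ (arc a len) zs) (cong (_++ map proj₁ zs) (map-proj₁-arc a len))

module WithoutGoodPairs {V₁ V₂ : Set} (G₁ : CGraph V₁) (G₂ : CGraph V₂) (X : V₁ → V₂ → Color) (n' m' : ℕ)
  {Nbr₁ : V₁ → Color → V₁ → Set} {Nbr₂ : V₂ → Color → V₂ → Set}
  (C₁ : PeriodicCycle (E G₁) (2 * suc (suc n')) Nbr₁) (C₂ : PeriodicCycle (E G₂) (2 * suc (suc m')) Nbr₂)
  (no-good-pair : ∀ v w c v' w' → X v w ≡ c → Nbr₁ v c v' → Nbr₂ w c w' → X v' w' ≢ c) where

  n m N₁ N₂ : ℕ
  n = suc (suc n')
  m = suc (suc m')
  N₁ = 2 * n
  N₂ = 2 * m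

  open PeriodicCycle C₁ public using () renaming (P to P₁; t to t₁; t-suc to t₁-suc; Nbr-suc to Nbr₁-suc)
  open PeriodicCycle C₂ public using () renaming (P to P₂; t to t₂; t-suc to t₂-suc; Nbr-pred to Nbr₂-pred)

  Y : ℕ → ℕ → Color
  Y k l = X (P₁ k) (P₂ l)

  module Diagonal (R : V₁ → Color → V₂ → Color → Set)
    (R-step : ∀ k l → R (P₁ k) (t₁ k) (P₂ (suc l)) (t₂ (suc l)) → R (P₁ (suc k)) (t₁ (suc k)) (P₂ l) (t₂ l)) where

    At : ℕ → ℕ → Set
    At k l = R (P₁ k) (t₁ k) (P₂ l) (t₂ l)

    private
      At-+*N₁ : ∀ k c l → At (k + c * N₁) l → At k l
      At-+*N₁ k c l r rewrite P-+*N C₁ k c | t-+*N C₁ k c = r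
      At-+*N₁⁻ : ∀ k c l → At k l → At (k + c * N₁) l
      At-+*N₁⁻ k c l r rewrite P-+*N C₁ k c | t-+*N C₁ k c = r
      At-+*N₂ : ∀ k l c → At k (l + c * N₂) → At k l
      At-+*N₂ k l c r rewrite P-+*N C₂ l c | t-+*N C₂ l c = r
      At-+*N₂⁻ : ∀ k l c → At k l → At k (l + c * N₂)
      At-+*N₂⁻ k l c r rewrite P-+*N C₂ l c | t-+*N C₂ l c = r

    slide : ∀ j k l → At k (l + j) → At (k + j) l
    slide zero k l r rewrite +-identityʳ k | +-identityʳ l = r
    slide (suc j) k l r rewrite +-suc k j = R-step (k + j) l (slide j k (suc l) (subst (At k) (+-suc l j) r))

    from-diagonal : ∀ k l → At 0 (k + l) → At k l
    from-diagonal k l r = slide k 0 l (subst (At 0) (+-comm k l) r)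

    -- Sliding by k (N₁ N₂ - 1) moves (k, l + k N₁ N₂) to (k N₁ N₂, k + l).
    to-diagonal : ∀ k l → At k l → At 0 (k + l)
    to-diagonal k l r =
      At-+*N₁ 0 (k * N₂) (k + l) (subst (λ i → At i (k + l)) (end k (pred N₁) (pred N₂))
        (slide (k * (pred N₁ + pred N₂ + pred N₁ * pred N₂)) k (k + l)
          (subst (At k) (start k l (pred N₁) (pred N₂)) (At-+*N₂⁻ k l (k * N₁) r))))
      where
      start : ∀ k l A B → l + k * suc A * suc B ≡ k + l + k * (A + B + A * B)
      start = solve-∀
      end : ∀ k A B → k + k * (A + B + A * B) ≡ k * suc B * suc A
      end = solve-∀

    OnDiagonal : ℕ → Set
    OnDiagonal s = At 0 s

    OnDiagonal-periodic₁ : Periodic OnDiagonal N₁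
    OnDiagonal-periodic₁ s = mk⇔
      (λ r → At-+*N₁ 0 1 s (subst (λ i → At i s) (sym (*-identityˡ N₁)) (from-diagonal N₁ s (subst OnDiagonal (+-comm s N₁) r))))
      (λ r → subst OnDiagonal (+-comm N₁ s) (to-diagonal N₁ s (subst (λ i → At i s) (*-identityˡ N₁) (At-+*N₁⁻ 0 1 s r))))

    OnDiagonal-periodic₂ : Periodic OnDiagonal N₂
    OnDiagonal-periodic₂ s = mk⇔
      (λ r → At-+*N₂ 0 s 1 (subst OnDiagonal (cong (s +_) (sym (+-identityʳ N₂))) r))
      (λ r → subst OnDiagonal (cong (s +_) (+-identityʳ N₂)) (At-+*N₂⁻ 0 s 1 r))

  -- Both kinds of exterior edge P₁ k P₂ l used by the cycles below are mixed (t₁ k ≢ t₂ l):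
  -- an exit leaves the C₁-arc ending at P₁ k (colour t₁ k) and enters C₂ at P₂ l, an entry
  -- leaves the C₂-arc ending at P₂ l (colour t₂ l) and enters C₁ at P₁ k.
  MixedR ExitR : V₁ → Color → V₂ → Color → Set
  MixedR v c w d = c ≢ d
  ExitR v c w d = c ≢ d × X v w ≡ c

  Mixed Exit Entry : ℕ → ℕ → Set
  Mixed k l = t₁ k ≢ t₂ l
  Exit k l = Mixed k l × Y k l ≡ t₁ k
  Entry k l = Mixed k l × Y k l ≡ t₂ l

  mixed-step : ∀ k l → Mixed k (suc l) → Mixed (suc k) l
  mixed-step k l mixed e = mixed (trans (sym (opp-involutive (t₁ k)))
    (trans (cong opp (trans (sym (t₁-suc k)) e)) (sym (t₂-suc l))))

  -- No good pair: the red (or blue) exterior edge P₁ k P₂ (l + 1) forbids that colour on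
  -- P₁ (k + 1) P₂ l.
  exit-step : ∀ k l → Exit k (suc l) → Exit (suc k) l
  exit-step k l (mixed , Y≡t₁) = mixed-step k l mixed , trans (≢⇒≡opp (≢-sym Y≢t₁)) (sym (t₁-suc k))
    where
    t₂≡t₁ : t₂ l ≡ t₁ k
    t₂≡t₁ = ≢opp⇒≡ (subst (t₁ k ≢_) (t₂-suc l) mixed)
    Y≢t₁ : Y (suc k) l ≢ t₁ k
    Y≢t₁ = no-good-pair _ _ (t₁ k) _ _ Y≡t₁ (Nbr₁-suc k) (subst (λ c → Nbr₂ (P₂ (suc l)) c (P₂ l)) t₂≡t₁ (Nbr₂-pred l))

  module Mixedness = Diagonal MixedR mixed-step
  module Exits = Diagonal ExitR exit-step

  μ ω : ℕ → Set
  μ = Mixedness.OnDiagonal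
  ω = Exits.OnDiagonal

  ω? : ∀ s → Dec (ω s)
  ω? s with t₁ 0 ≟ᶜ t₂ s | Y 0 s ≟ᶜ t₁ 0
  ... | yes same | _ = no λ exit → proj₁ exit same
  ... | no mixed | yes Y≡t₁ = yes (mixed , Y≡t₁)
  ... | no _ | no Y≢t₁ = no λ exit → Y≢t₁ (proj₂ exit)

  Exit⇒ω : ∀ k l → Exit k l → ω (k + l)
  Exit⇒ω = Exits.to-diagonal

  ω⇒Exit : ∀ k l → ω (k + l) → Exit k l
  ω⇒Exit = Exits.from-diagonal

  Entry⇒μ∧¬ω : ∀ k l → Entry k l → μ (k + l) × ¬ ω (k + l)
  Entry⇒μ∧¬ω k l (mixed , Y≡t₂) =
    Mixedness.to-diagonal k l mixed ,
    λ ωkl → mixed (trans (sym (proj₂ (ω⇒Exit k l ωkl))) Y≡t₂)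

  μ∧¬ω⇒Entry : ∀ k l → μ (k + l) → ¬ ω (k + l) → Entry k l
  μ∧¬ω⇒Entry k l μkl ¬ωkl =
    mixed , trans (≢⇒≡opp (λ e → ¬ωkl (Exit⇒ω k l (mixed , sym e)))) (sym (≢⇒≡opp mixed))
    where
    mixed = Mixedness.from-diagonal k l μkl

  μ-+2 : ∀ s → μ s → μ (suc (suc s))
  μ-+2 s μs e = μs (trans e (trans (t₂-suc (suc s)) (trans (cong opp (t₂-suc s)) (opp-involutive _))))

  μ-∸2 : ∀ s → μ (suc (suc s)) → μ s
  μ-∸2 s μs+2 e = μs+2 (trans e (trans (sym (opp-involutive _)) (trans (cong opp (sym (t₂-suc s))) (sym (t₂-suc (suc s))))))

  -- Two mixed diagonals have the same parity, so one is reached from the other by steps of 2.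
  μ-parity : ∀ a b → μ a → μ b → ∃[ c ] a + 2 * c ≡ b + a * N₂
  μ-parity a b μa μb = c , trans (cong (a +_) (sym d≡)) (reach a b (pred N₂))
    where
    reach : ∀ a b B → a + (b + B * a) ≡ b + a * suc B
    reach = solve-∀
    same-colour : t₂ (a + (b + pred N₂ * a)) ≡ t₂ a
    same-colour = trans (cong t₂ (reach a b (pred N₂))) (trans (t-+*N C₂ b a) (trans (≢⇒≡opp μb) (sym (≢⇒≡opp μa))))
    c = proj₁ (proj₁ (t-parity t₂ t₂-suc a (b + pred N₂ * a)) same-colour)
    d≡ = proj₂ (proj₁ (t-parity t₂ t₂-suc a (b + pred N₂ * a)) same-colour)

  record Switches : Set where
    field
      down : ℕ
      ω-down : ω down
      ¬ω-down+2 : ¬ ω (suc (suc down))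
      up : ℕ
      ¬ω-up : ¬ ω up
      ω-up+2 : ω (suc (suc up))
      μ-up : μ up

  switches : ∀ s₁ s₀ → ω s₁ → μ s₀ → ¬ ω s₀ → Switches
  switches s₁ s₀ ωs₁ μs₀ ¬ωs₀ = record
    { down = proj₁ D ; ω-down = proj₁ (proj₂ D) ; ¬ω-down+2 = proj₂ (proj₂ D)
    ; up = proj₁ U ; ¬ω-up = proj₁ (proj₂ U)
    ; ω-up+2 = decidable-stable (ω? _) (proj₂ (proj₂ U))
    ; μ-up = μ-∸2 (proj₁ U) (proj₁ (decidable-stable (ω? _) (proj₂ (proj₂ U))))
    }
    where
    ω-+*N₂ : ∀ s c → ω (s + c * N₂) ⇔ ω s
    ω-+*N₂ = Periodic-* Exits.OnDiagonal-periodic₂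
    D : ∃[ y ] ω y × ¬ ω (suc (suc y))
    D with μ-parity s₁ s₀ (proj₁ ωs₁) μs₀
    ... | c , e = change-by-2 ω? c s₁ ωs₁ (λ ω⁺ → ¬ωs₀ (to (ω-+*N₂ s₀ s₁) (subst ω e ω⁺)))
    U : ∃[ y ] ¬ ω y × ¬ ¬ ω (suc (suc y))
    U with μ-parity s₀ s₁ μs₀ (proj₁ ωs₁)
    ... | c , e = change-by-2 (¬? ∘ ω?) c s₀ ¬ωs₀ (λ ¬ω⁺ → ¬ω⁺ (subst ω (sym e) (from (ω-+*N₂ s₁ s₀) ωs₁)))

  SE : V₁ ⊎ V₂ → V₁ ⊎ V₂ → Maybe Color
  SE = sumE G₁ G₂ X

  open AltWalks SE
  module A₁ = Arcs C₁ {E' = SE} inj₁ (λ _ _ → refl)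
  module A₂ = Arcs C₂ {E' = SE} inj₂ (λ _ _ → refl)

  CycleThrough : ℕ → V₁ ⊎ V₂ → Set
  CycleThrough L v = Σ (AltCycle SE L) λ C → ∃[ i ] vert C i ≡ v

  exit-++ : ∀ a p b ys → Exit (a + p) b → AltWalk (A₂.stop b ∷ ys) →
            AltWalk (A₁.stop a ∷ A₁.arc (suc a) p ++ A₂.stop b ∷ ys)
  exit-++ a p b ys (mixed , Y≡t₁) walk = AltWalk-++ _ (A₁.arc (suc a) p) _ ys (A₁.AltWalk-arc a p)
    (subst (λ x → Step x (A₂.stop b)) (sym (A₁.lastStop-arc a p)) (cong just Y≡t₁ , mixed)) walk

  entry-++ : ∀ b q a ys → Entry a (b + q) → AltWalk (A₁.stop a ∷ ys) →
             AltWalk (A₂.stop b ∷ A₂.arc (suc b) q ++ A₁.stop a ∷ ys)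
  entry-++ b q a ys (mixed , Y≡t₂) walk = AltWalk-++ _ (A₂.arc (suc b) q) _ ys (A₂.AltWalk-arc b q)
    (subst (λ x → Step x (A₁.stop a)) (sym (A₂.lastStop-arc b q)) (cong just Y≡t₂ , ≢-sym mixed)) walk

  closing-entry : ∀ x xs b q a → Entry a (b + q) → Step (lastStop x (xs ++ A₂.stop b ∷ A₂.arc (suc b) q)) (A₁.stop a)
  closing-entry x xs b q a (mixed , Y≡t₂) =
    subst (λ z → Step z (A₁.stop a)) (sym (trans (lastStop-++ x xs _ _) (A₂.lastStop-arc b q)))
      (cong just Y≡t₂ , ≢-sym mixed)

  cycleFromWalk : ∀ x xs {L} → suc (length xs) ≡ L → AltWalk (x ∷ xs) → Step (lastStop x xs) x →
                  Unique (map proj₁ (x ∷ xs)) → CycleThrough L (proj₁ x)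
  cycleFromWalk x xs refl walk closing unique =
    closeWalk x xs walk closing unique , fz , refl

  twoArcCycle : ∀ a p b q → p < N₁ → q < N₂ → Exit (a + p) b → Entry a (b + q) →
                CycleThrough (suc (p + suc q)) (inj₁ (P₁ a))
  twoArcCycle a p b q p<N₁ q<N₂ exit entry =
    cycleFromWalk (A₁.stop a) stops length≡
      (exit-++ a p b _ exit (A₂.AltWalk-arc b q)) (closing-entry _ (A₁.arc (suc a) p) b q a entry)
      (subst Unique (sym (A₁.map-proj₁-arc-++ a (suc p) (A₂.arc b (suc q))))
        (Unique.++⁺ (Unique.map⁺ inj₁-injective (A₁.Unique-arcVertices a (suc p) p<N₁))
          (subst Unique (sym (A₂.map-proj₁-arc b (suc q))) (Unique.map⁺ inj₂-injective (A₂.Unique-arcVertices b (suc q) q<N₂)))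
          (subst (Disjoint _) (sym (A₂.map-proj₁-arc b (suc q))) (Disjoint-inj₁-inj₂ _ _))))
    where
    stops = A₁.arc (suc a) p ++ A₂.arc b (suc q)
    length≡ : suc (length stops) ≡ suc (p + suc q)
    length≡ = cong suc (trans (length-++ (A₁.arc (suc a) p)) (cong₂ _+_ (A₁.length-arc (suc a) p) (A₂.length-arc b (suc q))))

  fourArcCycle : ∀ a x₁ b y₁ x₂ y₂ → suc x₁ + suc x₂ ≤ N₁ → suc y₁ + suc y₂ ≤ N₂ →
                 Exit (a + x₁) b → Entry (a + suc x₁) (b + y₁) →
                 Exit (a + suc x₁ + x₂) (b + suc y₁) → Entry a (b + suc y₁ + y₂) →
                 CycleThrough (suc (x₁ + (suc y₁ + (suc x₂ + suc y₂)))) (inj₁ (P₁ a))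
  fourArcCycle a x₁ b y₁ x₂ y₂ x-fits y-fits exit₁ entry₁ exit₂ entry₂ =
    cycleFromWalk (A₁.stop a) stops length≡
      (exit-++ a x₁ b _ exit₁ (entry-++ b y₁ a₂ _ entry₁ (exit-++ a₂ x₂ b₂ _ exit₂ (A₂.AltWalk-arc b₂ y₂))))
      (subst (λ x → Step x (A₁.stop a))
        (sym (trans (lastStop-++ (A₁.stop a) (A₁.arc (suc a) x₁) _ _) (lastStop-++ (A₂.stop b) (A₂.arc (suc b) y₁) _ _)))
        (closing-entry _ (A₁.arc (suc a₂) x₂) b₂ y₂ a entry₂))
      (subst Unique (sym vertices≡)
        (Unique-interleave
          (A₁.Unique-arcVertices a (suc x₁) (≤-trans (m≤m+n (suc x₁) (suc x₂)) x-fits))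
          (A₁.Unique-arcVertices a₂ (suc x₂) (≤-trans (m≤n+m (suc x₂) (suc x₁)) x-fits))
          (A₁.Disjoint-arcVertices a (suc x₁) (suc x₂) x-fits)
          (A₂.Unique-arcVertices b (suc y₁) (≤-trans (m≤m+n (suc y₁) (suc y₂)) y-fits))
          (A₂.Unique-arcVertices b₂ (suc y₂) (≤-trans (m≤n+m (suc y₂) (suc y₁)) y-fits))
          (A₂.Disjoint-arcVertices b (suc y₁) (suc y₂) y-fits)))
    where
    a₂ = a + suc x₁
    b₂ = b + suc y₁
    stops = A₁.arc (suc a) x₁ ++ A₂.arc b (suc y₁) ++ A₁.arc a₂ (suc x₂) ++ A₂.arc b₂ (suc y₂)
    length≡ : suc (length stops) ≡ suc (x₁ + (suc y₁ + (suc x₂ + suc y₂)))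
    length≡ = cong suc (trans (length-++ (A₁.arc (suc a) x₁)) (cong₂ _+_ (A₁.length-arc (suc a) x₁)
                (trans (length-++ (A₂.arc b (suc y₁))) (cong₂ _+_ (A₂.length-arc b (suc y₁))
                  (trans (length-++ (A₁.arc a₂ (suc x₂))) (cong₂ _+_ (A₁.length-arc a₂ (suc x₂)) (A₂.length-arc b₂ (suc y₂))))))))
    vertices≡ : map proj₁ (A₁.stop a ∷ stops) ≡
                map inj₁ (A₁.arcVertices a (suc x₁)) ++ map inj₂ (A₂.arcVertices b (suc y₁)) ++
                map inj₁ (A₁.arcVertices a₂ (suc x₂)) ++ map inj₂ (A₂.arcVertices b₂ (suc y₂))
    vertices≡ = trans (A₁.map-proj₁-arc-++ a (suc x₁) (A₂.arc b (suc y₁) ++ A₁.arc a₂ (suc x₂) ++ A₂.arc b₂ (suc y₂)))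
                  (cong (map inj₁ (A₁.arcVertices a (suc x₁)) ++_)
                    (trans (A₂.map-proj₁-arc-++ b (suc y₁) (A₁.arc a₂ (suc x₂) ++ A₂.arc b₂ (suc y₂)))
                      (cong (map inj₂ (A₂.arcVertices b (suc y₁)) ++_)
                        (trans (A₁.map-proj₁-arc-++ a₂ (suc x₂) (A₂.arc b₂ (suc y₂)))
                          (cong (map inj₁ (A₁.arcVertices a₂ (suc x₂)) ++_) (A₂.map-proj₁-arc b₂ (suc y₂)))))))

  module CycleLengths (G' : ℕ) (T∣N₁ : 2 * suc G' ∣ N₁) (T∣N₂ : 2 * suc G' ∣ N₂)
                 (ω-periodic : Periodic ω (2 * suc G')) (μ-periodic : Periodic μ (2 * suc G'))
                 (sw : Switches) where
    open Switches sw

    G T : ℕ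
    G = suc G'
    T = 2 * G

    T≤N₁ : T ≤ N₁
    T≤N₁ = ∣⇒≤ T∣N₁

    T≤N₂ : T ≤ N₂
    T≤N₂ = ∣⇒≤ T∣N₂

    G≤T : G ≤ T
    G≤T = m≤m+n G (G + 0)

    exit-if : ∀ {s} → ω s → ∀ k l → (k + l) % T ≡ s % T → Exit k l
    exit-if ωs k l e = ω⇒Exit k l (from (Periodic⇒%-cong ω-periodic e) ωs)

    entry-if : ∀ {s} → μ s → ¬ ω s → ∀ k l → (k + l) % T ≡ s % T → Entry k l
    entry-if μs ¬ωs k l e =
      μ∧¬ω⇒Entry k l (from (Periodic⇒%-cong μ-periodic e) μs) (λ ωkl → ¬ωs (to (Periodic⇒%-cong ω-periodic e) ωkl))

    %-+*T : ∀ c s k {x} → x ≡ c + s + k * T → x % T ≡ (c + s) % T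
    %-+*T c s k e = trans (cong (_% T) e) ([m+kn]%n≡m%n (c + s) k T)

    up+r≡down : ∀ {r} → (down + (G' + G) * up) % T ≡ r → (up + r) % T ≡ down % T
    up+r≡down {r} W%T≡r = begin
      (up + r) % T                          ≡⟨ %-cong-+ˡ up T (trans (cong (_% T) (sym W%T≡r)) (m%n%n≡m%n W T)) ⟩
      (up + W) % T                          ≡⟨ %-+*T 0 down up (sum up down G') ⟩
      down % T                              ∎
      where
      open ≡-Reasoning
      W = down + (G' + G) * up
      sum : ∀ u d g → u + (d + (g + suc g) * u) ≡ 0 + d + u * (2 * suc g)
      sum = solve-∀

    -- b is chosen with a + p + b ≡ down (mod T); the congruence on q then puts the entry on down + 2.
    twoArcCycle-mod : ∀ a ℓ p q → 2 + (p + q) ≡ 2 * ℓ → p < N₁ → q < N₂ → q % T ≡ (2 + p) % T →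
                      CycleThrough (2 * ℓ) (inj₁ (P₁ a))
    twoArcCycle-mod a ℓ p q length≡ p<N₁ q<N₂ q≡2+p =
      subst (λ L → CycleThrough L (inj₁ (P₁ a))) (trans (cong suc (+-suc p q)) length≡)
        (twoArcCycle a p b q p<N₁ q<N₂
          (exit-if ω-down (a + p) b (trans (cong (_% T) (exit-sum a p down G')) ([m+kn]%n≡m%n down (a + p) T)))
          (entry-if (μ-+2 down (proj₁ ω-down)) ¬ω-down+2 a (b + q) entry-sum))
      where
      b = down + (G' + G) * (a + p)
      exit-sum : ∀ a p d g → a + p + (d + (g + suc g) * (a + p)) ≡ d + (a + p) * (2 * suc g)
      exit-sum = solve-∀
      entry-sum : (a + (b + q)) % T ≡ (2 + down) % T
      entry-sum = begin
        (a + (b + q)) % T          ≡⟨ cong (_% T) (sym (+-assoc a b q)) ⟩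
        (a + b + q) % T            ≡⟨ %-cong-+ˡ (a + b) T q≡2+p ⟩
        (a + b + (2 + p)) % T      ≡⟨ cong (_% T) (shift a p down G') ⟩
        (2 + down + (a + p) * T) % T ≡⟨ [m+kn]%n≡m%n (2 + down) (a + p) T ⟩
        (2 + down) % T             ∎
        where
        open ≡-Reasoning
        shift : ∀ a p d g → a + (d + (g + suc g) * (a + p)) + (2 + p) ≡ 2 + d + (a + p) * (2 * suc g)
        shift = solve-∀

    -- Four arcs: two stops of C₁, an arc of C₂, the remaining 2n - 2 stops of C₁ and the rest
    -- of C₂.  With a + b ≡ up + 1 the two arcs of C₂ must have lengths r and 2m - r where
    -- up + r ≡ down (mod T); r ≢ 0 because ω separates up from down.
    hamiltonianCycle : ∀ a → CycleThrough (N₁ + N₂) (inj₁ (P₁ a))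
    hamiltonianCycle a with (down + (G' + G) * up) % T in r≡
    ... | zero = ⊥-elim (¬ω-up (from (Periodic⇒%-cong ω-periodic (trans (cong (_% T) (sym (+-identityʳ up))) (up+r≡down r≡))) ω-down))
    ... | suc y₁ =
      subst (λ L → CycleThrough L (inj₁ (P₁ a))) length≡
        (fourArcCycle a 1 b y₁ x₂ y₂ (≤-reflexive x-fits) (≤-reflexive y-fits)
          (exit-if ω-up+2 (a + 1) b (%-+*T 2 up a (exit₁-sum a up G')))
          (entry-if (μ-+2 down (proj₁ ω-down)) ¬ω-down+2 (a + 2) (b + y₁)
            (trans (%-+*T 2 (up + suc y₁) a (entry₁-sum a up y₁ G')) (%-cong-+ˡ 2 T (up+r≡down r≡))))
          (exit-if ω-down (a + 2 + x₂) (b + suc y₁)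
            (trans (cong (_% T) (exit₂-sum a up y₁ G' n')) (trans (%-remove-+ʳ (up + suc y₁ + a * T) T∣N₁)
              (trans (%-+*T 0 (up + suc y₁) a refl) (up+r≡down r≡)))))
          (entry-if μ-up ¬ω-up a (b + suc y₁ + y₂)
            (trans (cong (_% T) (trans (entry₂-sum a up y₁ y₂ G') (cong (up + a * T +_) y-fits)))
              (trans (%-remove-+ʳ (up + a * T) T∣N₂) (%-+*T 0 up a refl)))))
      where
      W = down + (G' + G) * up
      b = suc up + (G' + G) * a
      x₂ = n' + suc n'
      suc-y₁<N₂ : suc y₁ < N₂
      suc-y₁<N₂ = subst (_< N₂) r≡ (<-≤-trans (m%n<n W T) T≤N₂)
      y₂ = N₂ ∸ suc (suc y₁)
      y-fits : suc y₁ + suc y₂ ≡ N₂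
      y-fits = trans (+-suc (suc y₁) y₂) (m+[n∸m]≡n suc-y₁<N₂)
      x-fits : suc 1 + suc x₂ ≡ N₁
      x-fits = lemma n'
        where lemma : ∀ n → 2 + suc (n + suc n) ≡ 2 * suc (suc n)
              lemma = solve-∀
      length≡ : suc (1 + (suc y₁ + (suc x₂ + suc y₂))) ≡ N₁ + N₂
      length≡ = trans (regroup x₂ y₁ y₂) (cong₂ _+_ x-fits y-fits)
        where regroup : ∀ x y z → suc (1 + (suc y + (suc x + suc z))) ≡ 2 + suc x + (suc y + suc z)
              regroup = solve-∀
      exit₁-sum : ∀ a u g → a + 1 + (suc u + (g + suc g) * a) ≡ 2 + u + a * (2 * suc g)
      exit₁-sum = solve-∀
      entry₁-sum : ∀ a u y g → a + 2 + (suc u + (g + suc g) * a + y) ≡ 2 + (u + suc y) + a * (2 * suc g)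
      entry₁-sum = solve-∀
      exit₂-sum : ∀ a u y g n → a + 2 + (n + suc n) + (suc u + (g + suc g) * a + suc y)
                               ≡ 0 + (u + suc y) + a * (2 * suc g) + 2 * suc (suc n)
      exit₂-sum = solve-∀
      entry₂-sum : ∀ a u y z g → a + (suc u + (g + suc g) * a + suc y + z) ≡ u + a * (2 * suc g) + (suc y + suc z)
      entry₂-sum = solve-∀

    shortCycle₂ : ∀ a L → 2 + L ≤ m → CycleThrough (2 * (2 + L)) (inj₁ (P₁ a))
    shortCycle₂ a L ℓ≤m =
      twoArcCycle-mod a (2 + L) p q length≡ (<-≤-trans (m%n<n L G) (≤-trans G≤T T≤N₁)) q<N₂ ([m+kn]%n≡m%n (2 + p) k T)
      where
      p = L % G
      k = L / G
      q = 2 + p + k * T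
      length≡ : 2 + (p + q) ≡ 2 * (2 + L)
      length≡ = trans (sum p k G') (cong (λ x → 2 * (2 + x)) (sym (m≡m%n+[m/n]*n L G)))
        where sum : ∀ p k g → 2 + (p + (2 + p + k * (2 * suc g))) ≡ 2 * (2 + (p + k * suc g))
              sum = solve-∀
      q<N₂ : q < N₂
      q<N₂ = <-≤-trans (s≤s (≤-trans (m≤n+m q p) (n≤1+n (p + q)))) (subst (_≤ N₂) (sym length≡) (*-monoʳ-≤ 2 ℓ≤m))

    shortCycle₁ : ∀ a L → 2 + L ≤ n → CycleThrough (2 * (2 + L)) (inj₁ (P₁ a))
    shortCycle₁ a L ℓ≤n =
      twoArcCycle-mod a (2 + L) p q length≡ p<N₁ (<-≤-trans (m%n<n (2 + L) G) (≤-trans G≤T T≤N₂))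
        (sym (trans (cong (_% T) 2+p≡) ([m+kn]%n≡m%n q k T)))
      where
      q = (2 + L) % G
      k = (2 + L) / G
      q≤ : q ≤ 2 * (1 + L)
      q≤ = ≤-trans (m%n≤m (2 + L) G) (subst (2 + L ≤_) (sym (sum L)) (m≤m+n (2 + L) L))
        where sum : ∀ L → 2 * (1 + L) ≡ 2 + L + L
              sum = solve-∀
      p = 2 * (1 + L) ∸ q
      p+q≡ : p + q ≡ 2 * (1 + L)
      p+q≡ = m∸n+n≡m q≤
      double : ∀ L → 2 + 2 * (1 + L) ≡ 2 * (2 + L)
      double = solve-∀
      length≡ : 2 + (p + q) ≡ 2 * (2 + L)
      length≡ = trans (cong (2 +_) p+q≡) (double L)
      2+p≡ : 2 + p ≡ q + k * T
      2+p≡ = +-cancelʳ-≡ q (2 + p) (q + k * T) (begin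
        2 + p + q                 ≡⟨ length≡ ⟩
        2 * (2 + L)               ≡⟨ cong (2 *_) (m≡m%n+[m/n]*n (2 + L) G) ⟩
        2 * (q + k * G)           ≡⟨ sum q k G ⟩
        q + k * T + q             ∎)
        where
        open ≡-Reasoning
        sum : ∀ q k g → 2 * (q + k * g) ≡ q + k * (2 * g) + q
        sum = solve-∀
      p<N₁ : p < N₁
      p<N₁ = <-≤-trans (s≤s (≤-trans (m∸n≤m (2 * (1 + L)) q) (n≤1+n _)))
               (subst (_≤ N₁) (sym (double L)) (*-monoʳ-≤ 2 ℓ≤n))

    longCycle : ∀ a L → n < 2 + L → m < 2 + L → 2 + L < n + m → CycleThrough (2 * (2 + L)) (inj₁ (P₁ a))
    longCycle a L n<ℓ m<ℓ ℓ<n+m =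
      let (p , q , p<N₁ , q<N₂ , length≡ , q+N₁≡2+p+N₂) = long-arc-lengths n m L (s≤s z≤n) n<ℓ m<ℓ ℓ<n+m
      in twoArcCycle-mod a (2 + L) p q length≡ p<N₁ q<N₂
           (trans (sym (%-remove-+ʳ q T∣N₁)) (trans (cong (_% T) q+N₁≡2+p+N₂) (%-remove-+ʳ (2 + p) T∣N₂)))

    cyclesThrough : ∀ a ℓ → 2 ≤ ℓ → ℓ ≤ n + m → CycleThrough (2 * ℓ) (inj₁ (P₁ a))
    cyclesThrough a 1 (s≤s ()) _
    cyclesThrough a (suc (suc L)) _ ℓ≤n+m with 2 + L ≟ n + m | 2 + L ≤? m | 2 + L ≤? n
    ... | yes ℓ≡n+m | _ | _ = subst (λ x → CycleThrough x (inj₁ (P₁ a)))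
                               (trans (sym (*-distribˡ-+ 2 n m)) (cong (2 *_) (sym ℓ≡n+m))) (hamiltonianCycle a)
    ... | no _ | yes ℓ≤m | _ = shortCycle₂ a L ℓ≤m
    ... | no _ | no _ | yes ℓ≤n = shortCycle₁ a L ℓ≤n
    ... | no ℓ≢n+m | no ℓ≰m | no ℓ≰n = longCycle a L (≰⇒> ℓ≰n) (≰⇒> ℓ≰m) (≤∧≢⇒< ℓ≤n+m ℓ≢n+m)

  cyclesThrough₁ : ∀ {k l k' l'} → Exit k l → Entry k' l' →
                   ∀ v ℓ → 2 ≤ ℓ → ℓ ≤ n + m → CycleThrough (2 * ℓ) (inj₁ v)
  cyclesThrough₁ {k} {l} {k'} {l'} exit entry v ℓ 2≤ℓ ℓ≤n+m with gcd n m in G≡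
  ... | zero = ⊥-elim (gcd[m,n]≢0 n m (inj₁ (λ ())) G≡)
  ... | suc G' =
    subst (λ u → CycleThrough (2 * ℓ) (inj₁ u)) P₁a≡v
      (CycleLengths.cyclesThrough G' (subst (_∣ N₁) (sym T≡) (gcd[m,n]∣m N₁ N₂)) (subst (_∣ N₂) (sym T≡) (gcd[m,n]∣n N₁ N₂))
        (subst (Periodic ω) (sym T≡) (Periodic-bézout bézout Exits.OnDiagonal-periodic₁ Exits.OnDiagonal-periodic₂))
        (subst (Periodic μ) (sym T≡) (Periodic-bézout bézout Mixedness.OnDiagonal-periodic₁ Mixedness.OnDiagonal-periodic₂))
        (switches (k + l) (k' + l') (Exit⇒ω k l exit) (proj₁ (Entry⇒μ∧¬ω k' l' entry)) (proj₂ (Entry⇒μ∧¬ω k' l' entry)))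
        a ℓ 2≤ℓ ℓ≤n+m)
    where
    T≡ : 2 * suc G' ≡ gcd N₁ N₂
    T≡ = trans (cong (2 *_) (sym G≡)) (c*gcd[m,n]≡gcd[cm,cn] 2 n m)
    bézout = Bézout.identity (gcd-GCD N₁ N₂)
    a = proj₁ (PeriodicCycle.P-surjective C₁ v)
    P₁a≡v = proj₂ (PeriodicCycle.P-surjective C₁ v)

  -- A position whose two cycle colours agree becomes mixed once C₂ is read backwards.
  Exitʳ Entryʳ : ℕ → ℕ → Set
  Exitʳ k l = t₁ k ≡ t₂ l × Y k l ≡ t₁ k
  Entryʳ k l = t₁ k ≡ t₂ l × Y k l ≡ opp (t₂ l)

  Y≡t₁⇒ : ∀ {k l} → Y k l ≡ t₁ k → Exit k l ⊎ Exitʳ k l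
  Y≡t₁⇒ {k} {l} Y≡ with t₁ k ≟ᶜ t₂ l
  ... | yes same = inj₂ (same , Y≡)
  ... | no mixed = inj₁ (mixed , Y≡)

  Y≡opp-t₁⇒ : ∀ {k l} → Y k l ≡ opp (t₁ k) → Entry k l ⊎ Entryʳ k l
  Y≡opp-t₁⇒ {k} {l} Y≡ with t₁ k ≟ᶜ t₂ l
  ... | yes same = inj₂ (same , trans Y≡ (cong opp same))
  ... | no mixed = inj₁ (mixed , trans Y≡ (sym (≢⇒≡opp mixed)))

  Y≡t₂⇒ : ∀ {k l} → Y k l ≡ t₂ l → Entry k l ⊎ Exitʳ k l
  Y≡t₂⇒ {k} {l} Y≡ with t₁ k ≟ᶜ t₂ l
  ... | yes same = inj₂ (same , trans Y≡ (sym same))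
  ... | no mixed = inj₁ (mixed , Y≡)

  Y≡opp-t₂⇒ : ∀ {k l} → Y k l ≡ opp (t₂ l) → Exit k l ⊎ Entryʳ k l
  Y≡opp-t₂⇒ {k} {l} Y≡ with t₁ k ≟ᶜ t₂ l
  ... | yes same = inj₂ (same , Y≡)
  ... | no mixed = inj₁ (mixed , trans Y≡ (trans (cong opp (≢⇒≡opp mixed)) (opp-involutive (t₁ k))))

module _ {V₁ V₂ : Set} (G₁ : CGraph V₁) (G₂ : CGraph V₂) (X : V₁ → V₂ → Color) where

  sumE-swap : ∀ u w → sumE G₁ G₂ X (swap u) (swap w) ≡ sumE G₂ G₁ (λ w v → X v w) u w
  sumE-swap (inj₁ _) (inj₁ _) = refl
  sumE-swap (inj₁ _) (inj₂ _) = refl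
  sumE-swap (inj₂ _) (inj₁ _) = refl
  sumE-swap (inj₂ _) (inj₂ _) = refl

  swapCycle : ∀ {L} → AltCycle (sumE G₂ G₁ (λ w v → X v w)) L → AltCycle (sumE G₁ G₂ X) L
  swapCycle C = record
    { vert = λ i → swap (vert C i)
    ; inj = λ {i} {j} e → inj C (trans (sym (swap-involutive _)) (trans (cong swap e) (swap-involutive _)))
    ; col = col C
    ; edge = λ i j next → trans (sumE-swap (vert C i) (vert C j)) (edge C i j next)
    ; alt = alt C
    }

module Pancyclic {V₁ V₂ : Set} (G₁ : CGraph V₁) (G₂ : CGraph V₂) (X : V₁ → V₂ → Color) (n' m' : ℕ)
  {Nbr₁ : V₁ → Color → V₁ → Set} {Nbr₂ : V₂ → Color → V₂ → Set}
  (C₁ : PeriodicCycle (E G₁) (2 * suc (suc n')) Nbr₁) (C₂ : PeriodicCycle (E G₂) (2 * suc (suc m')) Nbr₂)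
  (no-good-pair : ∀ v w c v' w' → X v w ≡ c → Nbr₁ v c v' → Nbr₂ w c w' → X v' w' ≢ c) where

  open WithoutGoodPairs G₁ G₂ X n' m' C₁ C₂ no-good-pair
  module Swapped = WithoutGoodPairs G₂ G₁ (λ w v → X v w) m' n' C₂ C₁
    (λ w v c w' v' Y≡c Nbr₂wc Nbr₁vc → no-good-pair v w c v' w' Y≡c Nbr₁vc Nbr₂wc)

  -- Read from C₂, an exit becomes an entry and vice versa.
  pancyclic : ∀ {k l k' l'} → Exit k l → Entry k' l' → VertexAltPancyclic (sumE G₁ G₂ X) (n + m)
  pancyclic exit entry (inj₁ v) ℓ 2≤ℓ ℓ≤n+m = cyclesThrough₁ exit entry v ℓ 2≤ℓ ℓ≤n+m
  pancyclic (mixed , Y≡t₁) (mixed' , Y≡t₂) (inj₂ w) ℓ 2≤ℓ ℓ≤n+m =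
    let (C , i , Cᵢ≡w) = Swapped.cyclesThrough₁ (≢-sym mixed' , Y≡t₂) (≢-sym mixed , Y≡t₁) w ℓ 2≤ℓ
                           (subst (ℓ ≤_) (+-comm n m) ℓ≤n+m)
    in swapCycle G₁ G₂ X C , i , cong swap Cᵢ≡w

no-alternating-2-cycle : ∀ {V} (G : CGraph V) → ¬ AltCycle (E G) 2
no-alternating-2-cycle G C = alt C fz (fs fz) (inj₁ refl) (just-injective (begin
  just (col C fz)      ≡⟨ sym (edge C fz (fs fz) (inj₁ refl)) ⟩
  E G (vert C fz) (vert C (fs fz)) ≡⟨ CGraph.sym G _ _ ⟩
  E G (vert C (fs fz)) (vert C fz) ≡⟨ edge C (fs fz) fz (inj₂ (refl , refl)) ⟩
  just (col C (fs fz)) ∎))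
  where open ≡-Reasoning

module FromHamiltonianCycles (n' m' : ℕ)
  (G₁ : CGraph (Fin (2 * suc (suc n')))) (G₂ : CGraph (Fin (2 * suc (suc m'))))
  (C₁ : AltCycle (E G₁) (2 * suc (suc n'))) (C₂ : AltCycle (E G₂) (2 * suc (suc m')))
  (ham₁ : Hamiltonian C₁) (ham₂ : Hamiltonian C₂)
  (X : Fin (2 * suc (suc n')) → Fin (2 * suc (suc m')) → Color)
  (no-good-pair : ¬ GoodPair G₁ G₂ X C₁ C₂) where

  U₁ = unroll _ C₁ ham₁
  U₂ = unroll _ C₂ ham₂
  module R₂ = Reverse _ (CGraph.sym G₂) U₂

  no-good-pair′ : ∀ v w c v' w' → X v w ≡ c → CycNbr C₁ v c v' → CycNbr C₂ w c w' → X v' w' ≢ c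
  no-good-pair′ v w c v' w' Xvw≡c v'≡vᶜ w'≡wᶜ Xv'w'≡c =
    no-good-pair (v , w , c , v' , w' , cong just Xvw≡c , v'≡vᶜ , w'≡wᶜ , cong just Xv'w'≡c)

  open WithoutGoodPairs G₁ G₂ X n' m' U₁ U₂ no-good-pair′
  module Rev = WithoutGoodPairs G₁ G₂ X n' m' U₁ R₂.reversed no-good-pair′

  Exitʳ⇒Exit : ∀ {k l} → Exitʳ k l → Rev.Exit k (l * R₂.N∸1)
  Exitʳ⇒Exit {k} {l} (same , Y≡t₁) =
    (λ e → opp-≢ (t₂ l) (trans (sym same) (trans e (R₂.reversed-t l)))) ,
    trans (cong (X (P₁ k)) (R₂.reversed-P l)) Y≡t₁

  Entryʳ⇒Entry : ∀ {k l} → Entryʳ k l → Rev.Entry k (l * R₂.N∸1)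
  Entryʳ⇒Entry {k} {l} (same , Y≡opp-t₂) =
    (λ e → opp-≢ (t₂ l) (trans (sym same) (trans e (R₂.reversed-t l)))) ,
    trans (cong (X (P₁ k)) (R₂.reversed-P l)) (trans Y≡opp-t₂ (sym (R₂.reversed-t l)))

  Somewhere : (ℕ → ℕ → Set) → Set
  Somewhere R = ∃[ k ] ∃[ l ] R k l

  colours-in-row : ∀ k → ¬ (SingularL G₁ G₂ X C₂ red (P₁ k) ⊎ SingularL G₁ G₂ X C₂ blue (P₁ k)) →
                   ∀ c → ∃[ l ] Y k l ≡ c
  colours-in-row k non-singular c =
    let (j , Xj≡c) = non-singular⇒all-colours (λ j → X (P₁ k) (vert C₂ j)) non-singular c
        (l , P₂l≡) = PeriodicCycle.P-surjective U₂ (vert C₂ j)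
    in l , trans (cong (X (P₁ k)) P₂l≡) Xj≡c

  colours-in-column : ∀ l → ¬ (SingularR G₁ G₂ X C₁ red (P₂ l) ⊎ SingularR G₁ G₂ X C₁ blue (P₂ l)) →
                      ∀ c → ∃[ k ] Y k l ≡ c
  colours-in-column l non-singular c =
    let (i , Xi≡c) = non-singular⇒all-colours (λ i → X (vert C₁ i) (P₂ l)) non-singular c
        (k , P₁k≡) = PeriodicCycle.P-surjective U₁ (vert C₁ i)
    in k , trans (cong (λ v → X v (P₂ l)) P₁k≡) Xi≡c

  exit-and-entry : (Somewhere Exit × Somewhere Entry) ⊎ (Somewhere Exitʳ × Somewhere Entryʳ) →
                   VertexAltPancyclic (sumE G₁ G₂ X) (n + m)
  exit-and-entry (inj₁ ((k , l , exit) , (k' , l' , entry))) =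
    Pancyclic.pancyclic G₁ G₂ X n' m' U₁ U₂ no-good-pair′ {k} {l} {k'} {l'} exit entry
  exit-and-entry (inj₂ ((k , l , exitʳ) , (k' , l' , entryʳ))) =
    Pancyclic.pancyclic G₁ G₂ X n' m' U₁ R₂.reversed no-good-pair′ {k} {l * R₂.N∸1} {k'} {l' * R₂.N∸1}
      (Exitʳ⇒Exit {k} {l} exitʳ) (Entryʳ⇒Entry {k'} {l'} entryʳ)

  pancyclic : (∃[ v ] ¬ (SingularL G₁ G₂ X C₂ red v ⊎ SingularL G₁ G₂ X C₂ blue v)) →
              (∃[ w ] ¬ (SingularR G₁ G₂ X C₁ red w ⊎ SingularR G₁ G₂ X C₁ blue w)) →
              VertexAltPancyclic (sumE G₁ G₂ X) (n + m)
  pancyclic (v , non-singular-v) (w , non-singular-w)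
    with PeriodicCycle.P-surjective U₁ v | PeriodicCycle.P-surjective U₂ w
  ... | k₀ , refl | l₀ , refl = exit-and-entry (both-or-both row-exit row-entry column-entry column-exit)
    where
    at : ∀ {R : ℕ → ℕ → Set} k l → R k l → Somewhere R
    at k l r = k , l , r
    row = colours-in-row k₀ non-singular-v
    column = colours-in-column l₀ non-singular-w
    row-exit : Somewhere Exit ⊎ Somewhere Exitʳ
    row-exit = let (l , Y≡) = row (t₁ k₀) in map⊎ (at k₀ l) (at k₀ l) (Y≡t₁⇒ {k₀} {l} Y≡)
    row-entry : Somewhere Entry ⊎ Somewhere Entryʳ
    row-entry = let (l , Y≡) = row (opp (t₁ k₀)) in map⊎ (at k₀ l) (at k₀ l) (Y≡opp-t₁⇒ {k₀} {l} Y≡)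
    column-entry : Somewhere Entry ⊎ Somewhere Exitʳ
    column-entry = let (k , Y≡) = column (t₂ l₀) in map⊎ (at k l₀) (at k l₀) (Y≡t₂⇒ {k} {l₀} Y≡)
    column-exit : Somewhere Exit ⊎ Somewhere Entryʳ
    column-exit = let (k , Y≡) = column (opp (t₂ l₀)) in map⊎ (at k l₀) (at k l₀) (Y≡opp-t₂⇒ {k} {l₀} Y≡)

mainTheorem2 : (n m : ℕ) (G₁ : CGraph (Fin (2 * n))) (G₂ : CGraph (Fin (2 * m)))
    (C₁ : AltCycle (E G₁) (2 * n)) (C₂ : AltCycle (E G₂) (2 * m)) →
    Hamiltonian C₁ → Hamiltonian C₂ →
    (X : Fin (2 * n) → Fin (2 * m) → Color) →
    ¬ GoodPair G₁ G₂ X C₁ C₂ →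
    (∃[ v ] ¬ (SingularL G₁ G₂ X C₂ red v ⊎ SingularL G₁ G₂ X C₂ blue v)) →
    (∃[ w ] ¬ (SingularR G₁ G₂ X C₁ red w ⊎ SingularR G₁ G₂ X C₁ blue w)) →
    VertexAltPancyclic (sumE G₁ G₂ X) (n + m)
mainTheorem2 zero _ _ _ _ _ _ _ _ _ (() , _) _
mainTheorem2 1 _ G₁ _ C₁ _ _ _ _ _ _ _ = ⊥-elim (no-alternating-2-cycle G₁ C₁)
mainTheorem2 (suc (suc _)) zero _ _ _ _ _ _ _ _ _ (() , _)
mainTheorem2 (suc (suc _)) 1 _ G₂ _ C₂ _ _ _ _ _ _ = ⊥-elim (no-alternating-2-cycle G₂ C₂)
mainTheorem2 (suc (suc n')) (suc (suc m')) G₁ G₂ C₁ C₂ ham₁ ham₂ X no-good-pair =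
  FromHamiltonianCycles.pancyclic n' m' G₁ G₂ C₁ C₂ ham₁ ham₂ X no-good-pair
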